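{- Let $s>0$ be an integer, $n\ge 2$, and $1\le i\le n$. Let $H$ be the graph with signature $\{s,2s,\dots,ns\}\setminus\{is\}$ (i.e. $K_n$, realized by the signature $\{s,2s,\dots,ns\}$, with the vertex labeled $is$ removed). Then for every $p\in\{1,\dots,n\}$ with $p\ne i$, the degree of the vertex labeled $ps$ in $H$ is $$\deg(ps)=\epsilon_i+\begin{cases} n-4 & \text{if } i<p\le n-i,\\ n-2 & \text{if } n-i<p<i,\\ n-3 & \text{otherwise},\end{cases}$$ where $\epsilon_i=1$ if $p=2i$ and $i\le\lfloor n/2\rfloor$, and $\epsilon_i=0$ otherwise.
   Context: For a finite set $S$ of integers, the graph with signature $S$ has vertex set $S$, and distinct $a,b\in S$ are adjacent iff $|a-b|\in S$. -}

module Defs where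

open import Data.Nat as ℕ using (ℕ; _*_; _≤_; _<_; _/_)
open import Data.Integer as ℤ using (ℤ; +_; _-_; ∣_∣)
import Data.Integer.Properties as ℤP
open import Data.List using (List; length; filter; map; upTo)
open import Data.List.Membership.DecPropositional ℤ._≟_ using (_∈_; _∈?_)
open import Data.Product using (_×_)
open import Relation.Binary.PropositionalEquality using (_≡_; _≢_)
open import Relation.Nullary using (¬_; Dec; yes; no)
open import Relation.Nullary.Decidable using (_×-dec_; ¬?)

-- Graph with signature S (a finite set of integers, given as a list):
-- vertex set S, distinct a, b adjacent iff |a - b| ∈ S.
Adj : List ℤ → ℤ → ℤ → Set
Adj S a b = a ≢ b × (+ ∣ a - b ∣) ∈ S

Adj? : (S : List ℤ) (a b : ℤ) → Dec (Adj S a b)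
Adj? S a b = ¬? (a ℤ.≟ b) ×-dec ((+ ∣ a - b ∣) ∈? S)

degree : List ℤ → ℤ → ℕ
degree S a = length (filter (Adj? S a) S)

sigH : ℕ → ℕ → ℕ → List ℤ
sigH s n i =
  filter (λ x → ¬? (x ℤ.≟ (+ (i * s))))
         (map (λ k → + (ℕ.suc k * s)) (upTo n))

ε : ℕ → ℕ → ℕ → ℤ
ε n i p with p ℕ.≟ 2 * i | i ℕ.≤? n / 2
... | yes _ | yes _ = + 1
... | _     | _     = + 0

module Submission where

-- Every vertex of H is qs with 1 ≤ q ≤ n and q ≠ i.  Since |ps − qs| = |p − q|·s
-- and |p − q| ≤ n, the vertex qs is adjacent to ps iff q ≠ p and |p − q| ≠ i.  So
-- deg(ps) counts the q ∈ [1, n] avoiding the four values i, p, p + i and p ∸ i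
-- (the last one is 0, hence harmless, when p ≤ i).  Removing these values from
-- [1, n] one at a time: i and p lie in range and are distinct; p + i is new and in
-- range iff p + i ≤ n; p ∸ i is in range iff i < p and is new unless it equals i,
-- that is unless p = 2i.  Hence
--     deg(ps) + (2 + [p + i ≤ n] + [i < p]) = [p = 2i] + n,
-- and [p = 2i] = ε because p ≤ n.  The three cases of the theorem are the three
-- possible values of the indicator pair ([p + i ≤ n], [i < p]).

open import Defs
open import Data.Nat using (ℕ; NonZero)

module Counting where
  open import Data.Bool using (true; false)
  open import Data.List using (List; []; _∷_; [_]; _++_; map; filter; upTo; length)
  import Data.List.Properties as List
  open import Data.Nat using (zero; suc; _+_; _≤_; _≟_; s≤s; z≤n)
  open import Data.Nat.Properties using (+-comm; +-identityʳ; ≤-refl; ≤-pred; ≤∧≢⇒<; <-irrefl; m≤n⇒m≤1+n)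
  open import Data.Product using (_×_; _,_; proj₂)
  open import Function using (_⇔_; mk⇔; Equivalence; _∘_)
  open import Level using (Level)
  open import Relation.Binary.PropositionalEquality using (_≡_; _≢_; refl; sym; trans; cong; cong₂; module ≡-Reasoning)
  open import Relation.Nullary using (Dec; _because_; yes; no; ¬_; ¬?; _×-dec_; contradiction)
  open import Relation.Unary using (Pred; Decidable)
  open import Relation.Unary.Properties using (U?)
  open Equivalence using (to; from)

  private variable
    a b ℓ ℓ′ : Level
    A : Set a
    B : Set b

  ⟦_⟧ : Dec A → ℕ
  ⟦ true because _ ⟧ = 1
  ⟦ false because _ ⟧ = 0

  ⟦yes⟧ : A → (a? : Dec A) → ⟦ a? ⟧ ≡ 1
  ⟦yes⟧ x (yes _) = refl
  ⟦yes⟧ x (no ¬x) = contradiction x ¬x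

  ⟦no⟧ : ¬ A → (a? : Dec A) → ⟦ a? ⟧ ≡ 0
  ⟦no⟧ ¬x (yes x) = contradiction x ¬x
  ⟦no⟧ ¬x (no _) = refl

  ⟦⟧-cong : A ⇔ B → (a? : Dec A) (b? : Dec B) → ⟦ a? ⟧ ≡ ⟦ b? ⟧
  ⟦⟧-cong A⇔B a? (yes y) = ⟦yes⟧ (from A⇔B y) a?
  ⟦⟧-cong A⇔B a? (no ¬y) = ⟦no⟧ (¬y ∘ to A⇔B) a?

  ⟦⟧-split : (B → A) → (a? : Dec A) (b? : Dec B) → ⟦ a? ⟧ ≡ ⟦ a? ×-dec ¬? b? ⟧ + ⟦ b? ⟧
  ⟦⟧-split B⇒A (yes _) (yes _) = refl
  ⟦⟧-split B⇒A (yes _) (no _) = refl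
  ⟦⟧-split B⇒A (no ¬x) (yes y) = contradiction (B⇒A y) ¬x
  ⟦⟧-split B⇒A (no _) (no _) = refl

  count : {P : Pred ℕ ℓ} → Decidable P → ℕ → ℕ
  count P? zero = 0
  count P? (suc n) = count P? n + ⟦ P? (suc n) ⟧

  count-cong : {P : Pred ℕ ℓ} {Q : Pred ℕ ℓ′} (P? : Decidable P) (Q? : Decidable Q) (n : ℕ) →
               (∀ q → 1 ≤ q → q ≤ n → P q ⇔ Q q) → count P? n ≡ count Q? n
  count-cong P? Q? zero _ = refl
  count-cong P? Q? (suc n) P⇔Q = cong₂ _+_
    (count-cong P? Q? n (λ q 1≤q q≤n → P⇔Q q 1≤q (m≤n⇒m≤1+n q≤n)))
    (⟦⟧-cong (P⇔Q (suc n) (s≤s z≤n) ≤-refl) (P? (suc n)) (Q? (suc n)))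

  count-U : (n : ℕ) → count U? n ≡ n
  count-U zero = refl
  count-U (suc n) = trans (cong (_+ 1) (count-U n)) (+-comm n 1)

  _without_ : Pred ℕ ℓ → ℕ → Pred ℕ ℓ
  (P without a) q = q ≢ a × P q

  _without?_ : {P : Pred ℕ ℓ} → Decidable P → (a : ℕ) → Decidable (P without a)
  (P? without? a) q = ¬? (q ≟ a) ×-dec P? q

  infixl 5 _without_ _without?_

  count-without-out : {P : Pred ℕ ℓ} (P? : Decidable P) (a n : ℕ) →
                      (1 ≤ a → a ≤ n → ¬ P a) → count (P? without? a) n ≡ count P? n
  count-without-out P? a n ¬Pa = count-cong (P? without? a) P? n
    (λ q 1≤q q≤n → mk⇔ proj₂ (λ Pq → (λ { refl → ¬Pa 1≤q q≤n Pq }) , Pq))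

  count-without-in : {P : Pred ℕ ℓ} (P? : Decidable P) {a : ℕ} (n : ℕ) →
                     1 ≤ a → a ≤ n → P a → suc (count (P? without? a) n) ≡ count P? n
  count-without-in P? zero (s≤s _) ()
  count-without-in P? {a} (suc n) 1≤a a≤1+n Pa with a ≟ suc n
  ... | no a≢1+n = cong₂ _+_
        (count-without-in P? n 1≤a (≤-pred (≤∧≢⇒< a≤1+n a≢1+n)) Pa)
        (⟦⟧-cong (mk⇔ proj₂ (λ Pq → a≢1+n ∘ sym , Pq)) _ _)
  ... | yes refl = begin
        suc (count (P? without? a) n + ⟦ (P? without? a) a ⟧)
          ≡⟨ cong (λ k → suc (count (P? without? a) n + k)) (⟦no⟧ (λ (a≢a , _) → a≢a refl) _) ⟩
        suc (count (P? without? a) n + 0)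
          ≡⟨ cong suc (+-identityʳ _) ⟩
        suc (count (P? without? a) n)
          ≡⟨ cong suc (count-without-out P? a n (λ _ a≤n _ → <-irrefl refl a≤n)) ⟩
        suc (count P? n)
          ≡⟨ +-comm 1 _ ⟩
        count P? n + 1
          ≡⟨ cong (count P? n +_) (sym (⟦yes⟧ Pa (P? a))) ⟩
        count P? n + ⟦ P? a ⟧ ∎
    where open ≡-Reasoning

  count-without : {P : Pred ℕ ℓ} (P? : Decidable P) (a n : ℕ) (b? : Dec B) →
                  B ⇔ (1 ≤ a × a ≤ n × P a) → ⟦ b? ⟧ + count (P? without? a) n ≡ count P? n
  count-without P? a n (yes y) B⇔ with (1≤a , a≤n , Pa) ← to B⇔ y = count-without-in P? n 1≤a a≤n Pa
  count-without P? a n (no ¬y) B⇔ =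
    count-without-out P? a n (λ 1≤a a≤n Pa → ¬y (from B⇔ (1≤a , a≤n , Pa)))

  length-filter-filter-map : {P : Pred B ℓ} {Q : Pred B ℓ′} (P? : Decidable P) (Q? : Decidable Q)
    (f : A → B) (xs : List A) →
    length (filter Q? (filter P? (map f xs))) ≡ length (filter (λ x → P? (f x) ×-dec Q? (f x)) xs)
  length-filter-filter-map P? Q? f [] = refl
  length-filter-filter-map P? Q? f (x ∷ xs) with P? (f x)
  ... | no _ = length-filter-filter-map P? Q? f xs
  ... | yes _ with Q? (f x)
  ...   | yes _ = cong suc (length-filter-filter-map P? Q? f xs)
  ...   | no _ = length-filter-filter-map P? Q? f xs

  length-filter-singleton : {P : Pred A ℓ} (P? : Decidable P) (x : A) → length (filter P? [ x ]) ≡ ⟦ P? x ⟧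
  length-filter-singleton P? x with P? x
  ... | yes _ = refl
  ... | no _ = refl

  count-upTo : {P : Pred ℕ ℓ} (P? : Decidable P) (n : ℕ) →
               length (filter (P? ∘ suc) (upTo n)) ≡ count P? n
  count-upTo P? zero = refl
  count-upTo {P = P} P? (suc n) = begin
    length (filter R? (upTo (suc n)))
      ≡⟨ cong (length ∘ filter R?) (sym (List.upTo-∷ʳ n)) ⟩
    length (filter R? (upTo n ++ [ n ]))
      ≡⟨ cong length (List.filter-++ R? (upTo n) [ n ]) ⟩
    length (filter R? (upTo n) ++ filter R? [ n ])
      ≡⟨ List.length-++ (filter R? (upTo n)) ⟩
    length (filter R? (upTo n)) + length (filter R? [ n ])
      ≡⟨ cong₂ _+_ (count-upTo P? n) (length-filter-singleton R? n) ⟩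
    count P? n + ⟦ P? (suc n) ⟧ ∎
    where
    open ≡-Reasoning
    R? : Decidable (P ∘ suc)
    R? = P? ∘ suc

module Avoidance where
  open Counting
  open import Data.Nat using (_+_; _*_; _∸_; _≤_; _<_; ∣_-_∣)
  open import Data.Nat.Properties
  open import Data.Nat.Tactic.RingSolver using (solve-∀)
  open import Data.Product using (_×_; _,_)
  open import Data.Sum using (_⊎_; inj₁; inj₂; [_,_]′)
  open import Data.Unit using (tt)
  open import Function using (_⇔_; mk⇔; Equivalence; _∘_)
  open import Level using (0ℓ)
  open import Relation.Binary.PropositionalEquality using (_≡_; _≢_; refl; sym; trans; cong; subst; module ≡-Reasoning)
  open import Relation.Nullary using (¬?; _×-dec_)
  open import Relation.Unary using (Pred; Decidable; U)
  open import Relation.Unary.Properties using (U?)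
  open Equivalence using (to; from)

  Avoid : ℕ → ℕ → Pred ℕ 0ℓ
  Avoid i p = U without i without p without (p + i) without (p ∸ i)

  avoid? : (i p : ℕ) → Decidable (Avoid i p)
  avoid? i p = U? without? i without? p without? (p + i) without? (p ∸ i)

  distance≡⇔ : ∀ {i p q} → 1 ≤ q → (∣ p - q ∣ ≡ i) ⇔ (q ≡ p + i ⊎ q ≡ p ∸ i)
  distance≡⇔ {i} {p} {q} 1≤q = mk⇔ sides at-distance
    where
    sides : ∣ p - q ∣ ≡ i → q ≡ p + i ⊎ q ≡ p ∸ i
    sides d≡i with ≤-total p q
    ... | inj₁ p≤q = inj₁ (trans (sym (m+[n∸m]≡n p≤q)) (cong (p +_) (trans (sym (m≤n⇒∣m-n∣≡n∸m p≤q)) d≡i)))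
    ... | inj₂ q≤p = inj₂ (trans (sym (m∸[m∸n]≡n q≤p)) (cong (p ∸_) (trans (sym (m≤n⇒∣n-m∣≡n∸m q≤p)) d≡i)))
    at-distance : q ≡ p + i ⊎ q ≡ p ∸ i → ∣ p - q ∣ ≡ i
    at-distance (inj₁ refl) = ∣m-m+n∣≡n p i
    at-distance (inj₂ refl) = trans (m≤n⇒∣n-m∣≡n∸m (m∸n≤m p i)) (m∸[m∸n]≡n i≤p)
      where
      i≤p : i ≤ p
      i≤p = <⇒≤ (m∸n≢0⇒n<m (>⇒≢ 1≤q))

  avoid⇔ : ∀ {i p q} → 1 ≤ q → (q ≢ i × q ≢ p × ∣ p - q ∣ ≢ i) ⇔ Avoid i p q
  avoid⇔ {i} {p} {q} 1≤q = mk⇔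
    (λ (q≢i , q≢p , d≢i) → d≢i ∘ from distance⇔ ∘ inj₂ , d≢i ∘ from distance⇔ ∘ inj₁ , q≢p , q≢i , tt)
    (λ (q≢p∸i , q≢p+i , q≢p , q≢i , _) → q≢i , q≢p , [ q≢p+i , q≢p∸i ]′ ∘ to distance⇔)
    where
    distance⇔ : (∣ p - q ∣ ≡ i) ⇔ (q ≡ p + i ⊎ q ≡ p ∸ i)
    distance⇔ = distance≡⇔ 1≤q

  2*i≡i+i : ∀ i → 2 * i ≡ i + i
  2*i≡i+i i = cong (i +_) (+-identityʳ i)

  p+i-removable⇔ : ∀ {n i p} → 1 ≤ i → 1 ≤ p →
    (p + i ≤ n) ⇔ (1 ≤ p + i × p + i ≤ n × (U without i without p) (p + i))
  p+i-removable⇔ {n} {i} {p} 1≤i 1≤p = mk⇔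
    (λ p+i≤n → ≤-trans 1≤p (m≤m+n p i) , p+i≤n , >⇒≢ (m<m+n p 1≤i) , >⇒≢ (m<n+m i 1≤p) , tt)
    (λ (_ , p+i≤n , _) → p+i≤n)

  p∸i-removable⇔ : ∀ {n i p} → 1 ≤ i → p ≤ n →
    (i < p × p ≢ 2 * i) ⇔ (1 ≤ p ∸ i × p ∸ i ≤ n × (U without i without p without (p + i)) (p ∸ i))
  p∸i-removable⇔ {n} {i} {p} 1≤i p≤n = mk⇔
    (λ (i<p , p≢2i) →
        m<n⇒0<n∸m i<p
      , ≤-trans (m∸n≤m p i) p≤n
      , <⇒≢ (≤-<-trans (m∸n≤m p i) (m<m+n p 1≤i))
      , <⇒≢ (∸-monoʳ-< 1≤i (<⇒≤ i<p))
      , p≢2i ∘ p∸i≡i⇒p≡2i (<⇒≤ i<p)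
      , tt)
    (λ (1≤p∸i , _ , _ , _ , p∸i≢i , _) →
        m∸n≢0⇒n<m (>⇒≢ 1≤p∸i)
      , λ p≡2i → p∸i≢i (trans (cong (_∸ i) (trans p≡2i (2*i≡i+i i))) (m+n∸m≡n i i)))
    where
    p∸i≡i⇒p≡2i : i ≤ p → p ∸ i ≡ i → p ≡ 2 * i
    p∸i≡i⇒p≡2i i≤p p∸i≡i = trans (sym (m∸n+n≡m i≤p)) (trans (cong (_+ i) p∸i≡i) (sym (2*i≡i+i i)))

  -- Removing i, p, p + i and p ∸ i from [1, n] one at a time; [i < p] splits as
  -- [i < p ∧ p ≠ 2i] + [p = 2i] because p = 2i forces i < p.
  count-avoid : ∀ {n i p} → 1 ≤ i → i ≤ n → 1 ≤ p → p ≤ n → p ≢ i →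
    count (avoid? i p) n + (2 + ⟦ p + i ≤? n ⟧ + ⟦ i <? p ⟧) ≡ ⟦ p ≟ 2 * i ⟧ + n
  count-avoid {n} {i} {p} 1≤i i≤n 1≤p p≤n p≢i = begin
    c₄ + (2 + x + ⟦ i <? p ⟧)  ≡⟨ cong (λ k → c₄ + (2 + x + k)) (⟦⟧-split p≡2i⇒i<p (i <? p) (p ≟ 2 * i)) ⟩
    c₄ + (2 + x + (y + e))     ≡⟨ rearrange c₄ x y e ⟩
    e + (2 + (x + (y + c₄)))   ≡⟨ cong (λ k → e + (2 + (x + k))) removed-p∸i ⟩
    e + (2 + (x + c₃))         ≡⟨ cong (λ k → e + (2 + k)) removed-p+i ⟩
    e + (2 + c₂)               ≡⟨ cong (λ k → e + (1 + k)) removed-p ⟩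
    e + (1 + c₁)               ≡⟨ cong (e +_) removed-i ⟩
    e + n                      ∎
    where
    open ≡-Reasoning
    x y e c₁ c₂ c₃ c₄ : ℕ
    x = ⟦ p + i ≤? n ⟧
    y = ⟦ (i <? p) ×-dec ¬? (p ≟ 2 * i) ⟧
    e = ⟦ p ≟ 2 * i ⟧
    c₁ = count (U? without? i) n
    c₂ = count (U? without? i without? p) n
    c₃ = count (U? without? i without? p without? (p + i)) n
    c₄ = count (avoid? i p) n

    rearrange : ∀ c x y e → c + (2 + x + (y + e)) ≡ e + (2 + (x + (y + c)))
    rearrange = solve-∀

    p≡2i⇒i<p : p ≡ 2 * i → i < p
    p≡2i⇒i<p p≡2i = subst (i <_) (sym (trans p≡2i (2*i≡i+i i))) (m<m+n i 1≤i)

    removed-i : 1 + c₁ ≡ n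
    removed-i = trans (count-without-in U? n 1≤i i≤n tt) (count-U n)

    removed-p : 1 + c₂ ≡ c₁
    removed-p = count-without-in (U? without? i) n 1≤p p≤n (p≢i , tt)

    removed-p+i : x + c₃ ≡ c₂
    removed-p+i = count-without (U? without? i without? p) (p + i) n (p + i ≤? n) (p+i-removable⇔ 1≤i 1≤p)

    removed-p∸i : y + c₄ ≡ c₃
    removed-p∸i = count-without (U? without? i without? p without? (p + i)) (p ∸ i) n
      ((i <? p) ×-dec ¬? (p ≟ 2 * i)) (p∸i-removable⇔ 1≤i p≤n)

module Neighbours (s n i : ℕ) .{{_ : NonZero s}} where
  open Counting using (count; count-cong; count-upTo; length-filter-filter-map)
  open Avoidance using (Avoid; avoid?; avoid⇔)
  open import Data.Integer as ℤ using (ℤ; +_)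
  import Data.Integer.Properties as ℤ
  open import Data.List using (List; map; upTo)
  open import Data.List.Membership.DecPropositional ℤ._≟_ using (_∈_)
  open import Data.List.Membership.Propositional.Properties
    using (∈-filter⁺; ∈-filter⁻; ∈-map⁺; ∈-map⁻; ∈-upTo⁺; ∈-upTo⁻)
  open import Data.Nat using (suc; _*_; _≤_; ∣_-_∣; s≤s; z≤n)
  open import Data.Nat.Properties
  open import Data.Product using (_×_; _,_)
  open import Data.Sum using (inj₁; inj₂)
  open import Function using (_⇔_; mk⇔; Equivalence; _∘_)
  open import Function.Construct.Composition using (_⇔-∘_)
  open import Level using (0ℓ)
  open import Relation.Binary.PropositionalEquality using (_≡_; _≢_; refl; sym; trans; cong; subst)
  open import Relation.Nullary using (¬?; _×-dec_)
  open import Relation.Unary using (Pred; Decidable)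
  open Equivalence using (to; from)

  S : List ℤ
  S = sigH s n i

  multiple-injective : ∀ {p q} → + (p * s) ≡ + (q * s) → p ≡ q
  multiple-injective = *-cancelʳ-≡ _ _ s ∘ ℤ.+-injective

  ∣+a-+b∣≡∣a-b∣ : ∀ a b → ℤ.∣ + a ℤ.- + b ∣ ≡ ∣ a - b ∣
  ∣+a-+b∣≡∣a-b∣ a b with ≤-total a b
  ... | inj₁ a≤b = trans (cong ℤ.∣_∣ (ℤ.m-n≡m⊖n a b))
                   (trans (ℤ.∣⊖∣-≤ a≤b) (sym (m≤n⇒∣m-n∣≡n∸m a≤b)))
  ... | inj₂ b≤a = trans (cong ℤ.∣_∣ (ℤ.m-n≡m⊖n a b))
                   (trans (ℤ.∣m⊖n∣≡∣n⊖m∣ a b) (trans (ℤ.∣⊖∣-≤ b≤a) (sym (m≤n⇒∣n-m∣≡n∸m b≤a))))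

  distance-multiples : ∀ p q → + ℤ.∣ + (p * s) ℤ.- + (q * s) ∣ ≡ + (∣ p - q ∣ * s)
  distance-multiples p q = cong +_ (trans (∣+a-+b∣≡∣a-b∣ (p * s) (q * s)) (sym (*-distribʳ-∣-∣ s p q)))

  ∈S⇔ : ∀ m → + (m * s) ∈ S ⇔ (1 ≤ m × m ≤ n × m ≢ i)
  ∈S⇔ m = mk⇔ into onto
    where
    ≢is? : Decidable (λ x → x ≢ + (i * s))
    ≢is? x = ¬? (x ℤ.≟ + (i * s))

    multiples : List ℤ
    multiples = map (λ k → + (suc k * s)) (upTo n)

    into : ∀ {m} → + (m * s) ∈ S → 1 ≤ m × m ≤ n × m ≢ i
    into {m} m∈S with ∈-filter⁻ ≢is? {xs = multiples} m∈S
    ... | m∈multiples , ms≢is with ∈-map⁻ (λ k → + (suc k * s)) m∈multiples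
    ...   | k , k∈upTo , ms≡[1+k]s with multiple-injective {m} {suc k} ms≡[1+k]s
    ...     | refl = s≤s z≤n , ∈-upTo⁻ k∈upTo , ms≢is ∘ cong (λ j → + (j * s))

    onto : ∀ {m} → 1 ≤ m × m ≤ n × m ≢ i → + (m * s) ∈ S
    onto {suc k} (_ , 1+k≤n , 1+k≢i) =
      ∈-filter⁺ ≢is? (∈-map⁺ (λ k → + (suc k * s)) (∈-upTo⁺ 1+k≤n)) (1+k≢i ∘ multiple-injective)

  adjacent⇔ : ∀ {p q} → p ≤ n → q ≤ n → Adj S (+ (p * s)) (+ (q * s)) ⇔ (q ≢ p × ∣ p - q ∣ ≢ i)
  adjacent⇔ {p} {q} p≤n q≤n = mk⇔
    (λ (ps≢qs , d∈S) → ps≢qs ∘ cong (λ j → + (j * s)) ∘ sym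
                     , to-distance d∈S)
    (λ (q≢p , d≢i) → q≢p ∘ sym ∘ multiple-injective
                   , subst (_∈ S) (sym (distance-multiples p q)) (from (∈S⇔ _) (1≤d q≢p , d≤n , d≢i)))
    where
    to-distance : + ℤ.∣ + (p * s) ℤ.- + (q * s) ∣ ∈ S → ∣ p - q ∣ ≢ i
    to-distance d∈S with _ , _ , d≢i ← to (∈S⇔ _) (subst (_∈ S) (distance-multiples p q) d∈S) = d≢i

    1≤d : q ≢ p → 1 ≤ ∣ p - q ∣
    1≤d q≢p = n≢0⇒n>0 (q≢p ∘ sym ∘ ∣m-n∣≡0⇒m≡n)

    d≤n : ∣ p - q ∣ ≤ n
    d≤n = ≤-trans (∣m-n∣≤m⊔n p q) (⊔-lub p≤n q≤n)

  Neighbour : ℕ → Pred ℕ 0ℓ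
  Neighbour p q = + (q * s) ≢ + (i * s) × Adj S (+ (p * s)) (+ (q * s))

  neighbour? : (p : ℕ) → Decidable (Neighbour p)
  neighbour? p q = ¬? (+ (q * s) ℤ.≟ + (i * s)) ×-dec Adj? S (+ (p * s)) (+ (q * s))

  neighbour⇔avoid : ∀ {p q} → p ≤ n → 1 ≤ q → q ≤ n → Neighbour p q ⇔ Avoid i p q
  neighbour⇔avoid p≤n 1≤q q≤n = avoid⇔ 1≤q ⇔-∘ mk⇔
    (λ (qs≢is , adj) → qs≢is ∘ cong (λ j → + (j * s)) , to (adjacent⇔ p≤n q≤n) adj)
    (λ (q≢i , q-rest) → q≢i ∘ multiple-injective , from (adjacent⇔ p≤n q≤n) q-rest)

  degree≡count-avoid : ∀ p → p ≤ n → degree S (+ (p * s)) ≡ count (avoid? i p) n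
  degree≡count-avoid p p≤n = trans
    (length-filter-filter-map (λ x → ¬? (x ℤ.≟ + (i * s))) (Adj? S (+ (p * s))) (λ k → + (suc k * s)) (upTo n))
    (trans (count-upTo (neighbour? p) n)
           (count-cong (neighbour? p) (avoid? i p) n (λ q 1≤q q≤n → neighbour⇔avoid p≤n 1≤q q≤n)))

open import Data.Nat using (_*_; _≤_; _<_; _∸_)
open import Data.Integer using (+_; _+_; _-_)
open import Data.Product using (_×_)
open import Relation.Binary.PropositionalEquality using (_≡_; _≢_)
open import Relation.Nullary using (¬_)

import Data.Nat as ℕ
import Data.Nat.Properties as ℕ
import Data.Integer.Properties as ℤ
open import Data.Empty using (⊥-elim)
open import Data.Integer using (-_)
open import Data.Nat.DivMod using (m*n/n≡m; /-monoˡ-≤)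
open import Data.Product using (_,_)
open import Function using (_∘_)
open import Relation.Binary.Definitions using (tri<; tri≈; tri>)
open import Relation.Binary.PropositionalEquality using (refl; sym; trans; cong; subst; module ≡-Reasoning)
open import Relation.Nullary using (yes; no)
open Counting using (⟦_⟧; ⟦yes⟧; ⟦no⟧; count)
open Avoidance using (avoid?; count-avoid)

2i≤n⇒i≤n/2 : ∀ {i n} → 2 * i ≤ n → i ≤ n ℕ./ 2
2i≤n⇒i≤n/2 {i} 2i≤n =
  subst (_≤ _) (trans (cong (ℕ._/ 2) (ℕ.*-comm 2 i)) (m*n/n≡m i 2)) (/-monoˡ-≤ 2 2i≤n)

ε≡⟦p≟2i⟧ : ∀ {n i p} → p ≤ n → ε n i p ≡ + ⟦ p ℕ.≟ 2 * i ⟧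
ε≡⟦p≟2i⟧ {n} {i} {p} p≤n with p ℕ.≟ 2 * i | i ℕ.≤? n ℕ./ 2
... | no _ | _ = refl
... | yes _ | yes _ = refl
... | yes p≡2i | no i≰n/2 = ⊥-elim (i≰n/2 (2i≤n⇒i≤n/2 (subst (_≤ n) p≡2i p≤n)))

+-offset : ∀ a c e m → a ℕ.+ c ≡ e ℕ.+ m → + a ≡ + e + (+ m - + c)
+-offset a c e m a+c≡e+m = begin
  + a                    ≡⟨ sym (ℤ.+-identityʳ (+ a)) ⟩
  + a + + 0              ≡⟨ cong (λ k → + a + k) (sym (ℤ.+-inverseʳ (+ c))) ⟩
  + a + (+ c - + c)      ≡⟨ sym (ℤ.+-assoc (+ a) (+ c) (- + c)) ⟩
  + (a ℕ.+ c) - + c      ≡⟨ cong (λ k → + k - + c) a+c≡e+m ⟩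
  + (e ℕ.+ m) - + c      ≡⟨ ℤ.+-assoc (+ e) (+ m) (- + c) ⟩
  + e + (+ m - + c)      ∎
  where open ≡-Reasoning

degree-formula : ∀ {s n i p} .{{_ : NonZero s}} → 1 ≤ i → i ≤ n → 1 ≤ p → p ≤ n → p ≢ i →
  + degree (sigH s n i) (+ (p * s)) ≡ ε n i p + (+ n - + (2 ℕ.+ ⟦ p ℕ.+ i ℕ.≤? n ⟧ ℕ.+ ⟦ i ℕ.<? p ⟧))
degree-formula {s} {n} {i} {p} 1≤i i≤n 1≤p p≤n p≢i = begin
  + degree (sigH s n i) (+ (p * s))  ≡⟨ cong +_ (Neighbours.degree≡count-avoid s n i p p≤n) ⟩
  + count (avoid? i p) n             ≡⟨ +-offset _ _ _ n (count-avoid 1≤i i≤n 1≤p p≤n p≢i) ⟩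
  + ⟦ p ℕ.≟ 2 * i ⟧ + (+ n - + c)    ≡⟨ cong (_+ (+ n - + c)) (sym (ε≡⟦p≟2i⟧ p≤n)) ⟩
  ε n i p + (+ n - + c)              ∎
  where
  open ≡-Reasoning
  c : ℕ
  c = 2 ℕ.+ ⟦ p ℕ.+ i ℕ.≤? n ⟧ ℕ.+ ⟦ i ℕ.<? p ⟧

-- The three cases of the theorem are the three values of ([p + i ≤ n], [i < p]):
-- (1, 1), (0, 0), and (0, 1) or (1, 0).
lemma3 : (s n i p : ℕ) → 0 < s → 2 ≤ n → 1 ≤ i → i ≤ n → 1 ≤ p → p ≤ n → p ≢ i →
    ((i < p × p ≤ n ∸ i) → + degree (sigH s n i) (+ (p * s)) ≡ ε n i p + (+ n - + 4))
    × ((n ∸ i < p × p < i) → + degree (sigH s n i) (+ (p * s)) ≡ ε n i p + (+ n - + 2))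
    × (¬ (i < p × p ≤ n ∸ i) → ¬ (n ∸ i < p × p < i) →
    + degree (sigH s n i) (+ (p * s)) ≡ ε n i p + (+ n - + 3))
lemma3 s n i p 0<s _ 1≤i i≤n 1≤p p≤n p≢i = inner , outer , middle
  where
  instance
    s≢0 : NonZero s
    s≢0 = ℕ.>-nonZero 0<s

  Degree≡ : ℕ → Set
  Degree≡ c = + degree (sigH s n i) (+ (p * s)) ≡ ε n i p + (+ n - + c)

  degree-when : ∀ {x z} → ⟦ p ℕ.+ i ℕ.≤? n ⟧ ≡ x → ⟦ i ℕ.<? p ⟧ ≡ z → Degree≡ (2 ℕ.+ x ℕ.+ z)
  degree-when refl refl = degree-formula 1≤i i≤n 1≤p p≤n p≢i

  p+i≤n : p ≤ n ∸ i → p ℕ.+ i ≤ n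
  p+i≤n = ℕ.m≤o∸n⇒m+n≤o p i≤n

  p≤n∸i : p ℕ.+ i ≤ n → p ≤ n ∸ i
  p≤n∸i = ℕ.m+n≤o⇒m≤o∸n p

  inner : i < p × p ≤ n ∸ i → Degree≡ 4
  inner (i<p , p≤n-i) = degree-when (⟦yes⟧ (p+i≤n p≤n-i) _) (⟦yes⟧ i<p _)

  outer : n ∸ i < p × p < i → Degree≡ 2
  outer (n-i<p , p<i) = degree-when (⟦no⟧ (ℕ.<⇒≱ n-i<p ∘ p≤n∸i) _) (⟦no⟧ (ℕ.<⇒≯ p<i) _)

  middle : ¬ (i < p × p ≤ n ∸ i) → ¬ (n ∸ i < p × p < i) → Degree≡ 3
  middle ¬inner ¬outer with ℕ.<-cmp i p
  ... | tri< i<p _ _ = degree-when (⟦no⟧ (λ p+i≤n → ¬inner (i<p , p≤n∸i p+i≤n)) _) (⟦yes⟧ i<p _)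
  ... | tri≈ _ i≡p _ = ⊥-elim (p≢i (sym i≡p))
  ... | tri> _ _ p<i = degree-when (⟦yes⟧ (p+i≤n (ℕ.≮⇒≥ (λ n-i<p → ¬outer (n-i<p , p<i)))) _) (⟦no⟧ (ℕ.<⇒≯ p<i) _)
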